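{- Let $n,m\ge 1$ be integers and $p\in[0,1]$. Let $G^*(n,m,p)$ be the random bipartite graph with disjoint vertex sets $V$ ($|V|=n$) and $W$ ($|W|=m$), in which each pair $\{v,w\}$ with $v\in V$, $w\in W$ is an edge independently with probability $p$. Let $G^{active}(n,m,p)$ be the graph on $V$ in which distinct $v_1,v_2\in V$ are adjacent iff some $w\in W$ is adjacent in $G^*(n,m,p)$ to both, and $G^{passive}(n,m,p)$ the graph on $W$ in which distinct $w_1,w_2\in W$ are adjacent iff some $v\in V$ is adjacent in $G^*(n,m,p)$ to both. Fix $v\in V$, $w\in W$, let $X$ be the degree of $v$ in $G^{active}(n,m,p)$ and $Y$ the degree of $w$ in $G^{passive}(n,m,p)$. Then for all real $x,y$, $$ \mathbb{E}\,x^X=\sum_{k=0}^{n-1}{n-1 \choose k}x^{n-1-k}(1-x)^k \big[1-p+p(1-p)^k\big]^{m} $$ and $$ \mathbb{E}\,y^Y=\sum_{l=0}^{m-1}{m-1 \choose l}y^{m-1-l}(1-y)^l \big[1-p+p(1-p)^l\big]^{n}. $$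
   Context: Convention: $0^0=1$. -}

module Defs where

open import Level using (Level)
open import Data.Nat using (ℕ; zero; suc; _∸_)
open import Data.Nat.Combinatorics using (_C_)
open import Data.Fin using (Fin; zero; suc; toℕ; _≟_)
open import Data.Bool using (Bool; true; false; _∧_; _∨_; if_then_else_)
open import Data.List using (List; []; _∷_; map; concatMap)
open import Relation.Nullary using (does)
open import Algebra.Bundles using (CommutativeRing)

_∷ᶠ_ : ∀ {a} {A : Set a} {k : ℕ} → A → (Fin k → A) → Fin (suc k) → A
(x ∷ᶠ f) zero = x
(x ∷ᶠ f) (suc i) = f i

allFns : ∀ {a} {A : Set a} (k : ℕ) → List A → List (Fin k → A)
allFns zero xs = (λ ()) ∷ []
allFns (suc k) xs = concatMap (λ x → map (λ f → x ∷ᶠ f) (allFns k xs)) xs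

BipGraph : ℕ → ℕ → Set
BipGraph n m = Fin n → Fin m → Bool

allBipGraphs : (n m : ℕ) → List (BipGraph n m)
allBipGraphs n m = allFns n (allFns m (true ∷ false ∷ []))

anyF : (k : ℕ) → (Fin k → Bool) → Bool
anyF zero f = false
anyF (suc k) f = f zero ∨ anyF k (λ i → f (suc i))

sumℕ : (k : ℕ) → (Fin k → ℕ) → ℕ
sumℕ zero f = 0
sumℕ (suc k) f = f zero Data.Nat.+ sumℕ k (λ i → f (suc i))

degActive : ∀ {n m} → BipGraph n m → Fin n → ℕ
degActive {n} {m} G v =
  sumℕ n (λ v' → if does (v' ≟ v) then 0
                  else (if anyF m (λ w → G v w ∧ G v' w) then 1 else 0))

degPassive : ∀ {n m} → BipGraph n m → Fin m → ℕ
degPassive {n} {m} G w =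
  sumℕ m (λ w' → if does (w' ≟ w) then 0
                  else (if anyF n (λ v → G v w ∧ G v w') then 1 else 0))

module RingDefs {c ℓ : Level} (R : CommutativeRing c ℓ) where
  open CommutativeRing R using (Carrier; _+_; _*_; _-_; 0#; 1#)

  -- x ^ k with x ^ 0 = 1 (convention 0^0 = 1)
  pow : Carrier → ℕ → Carrier
  pow x zero = 1#
  pow x (suc k) = x * pow x k

  times : ℕ → Carrier → Carrier
  times zero r = 0#
  times (suc k) r = r + times k r

  sumF : (k : ℕ) → (Fin k → Carrier) → Carrier
  sumF zero f = 0#
  sumF (suc k) f = f zero + sumF k (λ i → f (suc i))

  prodF : (k : ℕ) → (Fin k → Carrier) → Carrier
  prodF zero f = 1#
  prodF (suc k) f = f zero * prodF k (λ i → f (suc i))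

  sumL : List Carrier → Carrier
  sumL [] = 0#
  sumL (r ∷ rs) = r + sumL rs

  -- probability of the graph G under G*(n,m,p): product of p over edges
  -- and (1 - p) over non-edges
  weight : ∀ {n m} → Carrier → BipGraph n m → Carrier
  weight {n} {m} p G =
    prodF n (λ v → prodF m (λ w → if G v w then p else (1# - p)))

  expect : (n m : ℕ) → Carrier → (BipGraph n m → Carrier) → Carrier
  expect n m p f = sumL (map (λ G → weight p G * f G) (allBipGraphs n m))

  rhs : (N M : ℕ) → Carrier → Carrier → Carrier
  rhs N M p x =
    sumF N (λ i → times ((N ∸ 1) C toℕ i)
      (pow x ((N ∸ 1) ∸ toℕ i) * pow (1# - x) (toℕ i)
        * pow ((1# - p) + p * pow (1# - p) (toℕ i)) M))

-- The rows G v of the random bipartite graph are independent random vectors in {0,1}^W.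
-- Conditioning on the row a = G v, the indicators "v' is adjacent to v in G^active" for
-- v' ≠ v are independent, and x^[v ~ v'] has mean x + (1 - x) q(a), where
-- q(a) = ∏_{w ∈ a} (1 - p) is the probability that a fresh row misses every neighbour of v.
-- Hence E x^X = E_a (x + (1 - x) q(a))^(n-1); expanding binomially leaves the moments
-- E q(a)^k = (1 - p + p (1 - p)^k)^m, again by independence of the entries of a.
-- The passive degree is the active degree of the transposed graph, and transposition
-- preserves the distribution of a matrix with i.i.d. entries.

module Submission where

open import Defs
open import Level using (Level; _⊔_)
open import Data.Nat as ℕ using (ℕ; zero; suc; _∸_)
open import Data.Nat.Combinatorics using (_C_)
open import Data.Fin using (Fin; zero; suc; toℕ; _≟_)
open import Data.Bool using (Bool; true; false; _∧_; _∨_; if_then_else_)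
open import Data.List using (List; []; _∷_; map; concatMap; _++_)
open import Data.Product using (_×_; _,_)
open import Relation.Nullary using (does)
open import Relation.Binary.PropositionalEquality as ≡ using (_≡_)
open import Algebra.Bundles using (CommutativeRing)

sumℕ-cong : ∀ k {f g : Fin k → ℕ} → (∀ i → f i ≡ g i) → sumℕ k f ≡ sumℕ k g
sumℕ-cong zero e = ≡.refl
sumℕ-cong (suc k) e = ≡.cong₂ ℕ._+_ (e zero) (sumℕ-cong k (λ i → e (suc i)))

anyF-cong : ∀ k {f g : Fin k → Bool} → (∀ i → f i ≡ g i) → anyF k f ≡ anyF k g
anyF-cong zero e = ≡.refl
anyF-cong (suc k) e = ≡.cong₂ _∨_ (e zero) (anyF-cong k (λ i → e (suc i)))

module Expectation {c ℓ : Level} (R : CommutativeRing c ℓ) where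
  open CommutativeRing R hiding (zero)
  open RingDefs R
  open import Relation.Binary.Reasoning.Setoid setoid
  open import Algebra.Solver.Ring.NaturalCoefficients.Default commutativeSemiring
    using (solve; _:=_; _:+_; _:*_)
  open import Algebra.Properties.CommutativeSemiring.Binomial commutativeSemiring
    as Binomial using ()
  open import Algebra.Properties.Semiring.Exp semiring using () renaming (_^_ to _^ᴿ_)
  open import Algebra.Properties.Semiring.Mult semiring using () renaming (_×_ to _×ᴿ_)
  open import Algebra.Properties.Semiring.Sum semiring using (sum)

  x+[1-x]≈1 : ∀ u → u + (1# - u) ≈ 1#
  x+[1-x]≈1 u = begin
    u + (1# + - u) ≈⟨ +-cong refl (+-comm 1# (- u)) ⟩
    u + (- u + 1#) ≈⟨ sym (+-assoc u (- u) 1#) ⟩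
    (u + - u) + 1# ≈⟨ +-cong (-‿inverseʳ u) refl ⟩
    0# + 1#        ≈⟨ +-identityˡ 1# ⟩
    1#             ∎

  private variable
    a b : Level
    A : Set a
    B : Set b

  sumMap : List A → (A → Carrier) → Carrier
  sumMap xs g = sumL (map g xs)

  sumMap-cong : ∀ (xs : List A) {g h : A → Carrier} → (∀ x → g x ≈ h x) →
                sumMap xs g ≈ sumMap xs h
  sumMap-cong []       e = refl
  sumMap-cong (x ∷ xs) e = +-cong (e x) (sumMap-cong xs e)

  sumMap-0 : ∀ (xs : List A) → sumMap xs (λ _ → 0#) ≈ 0#
  sumMap-0 []       = refl
  sumMap-0 (x ∷ xs) = trans (+-cong refl (sumMap-0 xs)) (+-identityˡ 0#)

  sumMap-+ : ∀ (xs : List A) (g h : A → Carrier) →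
             sumMap xs (λ x → g x + h x) ≈ sumMap xs g + sumMap xs h
  sumMap-+ []       g h = sym (+-identityˡ 0#)
  sumMap-+ (x ∷ xs) g h = begin
    (g x + h x) + sumMap xs (λ x → g x + h x)
      ≈⟨ +-cong refl (sumMap-+ xs g h) ⟩
    (g x + h x) + (sumMap xs g + sumMap xs h)
      ≈⟨ solve 4 (λ a b c d → (a :+ b) :+ (c :+ d) := (a :+ c) :+ (b :+ d))
               refl (g x) (h x) (sumMap xs g) (sumMap xs h) ⟩
    (g x + sumMap xs g) + (h x + sumMap xs h) ∎

  sumMap-*ˡ : ∀ (xs : List A) r (g : A → Carrier) →
              sumMap xs (λ x → r * g x) ≈ r * sumMap xs g
  sumMap-*ˡ []       r g = sym (zeroʳ r)
  sumMap-*ˡ (x ∷ xs) r g =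
    trans (+-cong refl (sumMap-*ˡ xs r g)) (sym (distribˡ r (g x) (sumMap xs g)))

  sumMap-*ʳ : ∀ (xs : List A) r (g : A → Carrier) →
              sumMap xs (λ x → g x * r) ≈ sumMap xs g * r
  sumMap-*ʳ xs r g = begin
    sumMap xs (λ x → g x * r) ≈⟨ sumMap-cong xs (λ x → *-comm (g x) r) ⟩
    sumMap xs (λ x → r * g x) ≈⟨ sumMap-*ˡ xs r g ⟩
    r * sumMap xs g           ≈⟨ *-comm r _ ⟩
    sumMap xs g * r           ∎

  sumMap-times : ∀ (xs : List A) k (g : A → Carrier) →
                 sumMap xs (λ x → times k (g x)) ≈ times k (sumMap xs g)
  sumMap-times xs zero    g = sumMap-0 xs
  sumMap-times xs (suc k) g = trans (sumMap-+ xs _ _) (+-cong refl (sumMap-times xs k g))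

  sumMap-sumF : ∀ (xs : List A) k (g : A → Fin k → Carrier) →
                sumMap xs (λ x → sumF k (g x)) ≈ sumF k (λ i → sumMap xs (λ x → g x i))
  sumMap-sumF xs zero    g = sumMap-0 xs
  sumMap-sumF xs (suc k) g =
    trans (sumMap-+ xs _ _) (+-cong refl (sumMap-sumF xs k (λ x i → g x (suc i))))

  sumMap-swap : (xs : List A) (ys : List B) (g : A → B → Carrier) →
                sumMap xs (λ x → sumMap ys (g x)) ≈ sumMap ys (λ y → sumMap xs (λ x → g x y))
  sumMap-swap []       ys g = sym (sumMap-0 ys)
  sumMap-swap (x ∷ xs) ys g =
    trans (+-cong refl (sumMap-swap xs ys g)) (sym (sumMap-+ ys (g x) _))

  sumMap-++ : ∀ (xs ys : List A) (g : A → Carrier) →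
              sumMap (xs ++ ys) g ≈ sumMap xs g + sumMap ys g
  sumMap-++ []       ys g = sym (+-identityˡ _)
  sumMap-++ (x ∷ xs) ys g = trans (+-cong refl (sumMap-++ xs ys g)) (sym (+-assoc _ _ _))

  sumMap-map : (xs : List A) (f : A → B) (g : B → Carrier) →
               sumMap (map f xs) g ≈ sumMap xs (λ x → g (f x))
  sumMap-map []       f g = refl
  sumMap-map (x ∷ xs) f g = +-cong refl (sumMap-map xs f g)

  sumMap-concatMap : (xs : List A) (h : A → List B) (g : B → Carrier) →
                     sumMap (concatMap h xs) g ≈ sumMap xs (λ x → sumMap (h x) g)
  sumMap-concatMap []       h g = refl
  sumMap-concatMap (x ∷ xs) h g =
    trans (sumMap-++ (h x) (concatMap h xs) g) (+-cong refl (sumMap-concatMap xs h g))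

  sumMap-allFns-suc : ∀ (xs : List A) k (g : (Fin (suc k) → A) → Carrier) →
    sumMap (allFns (suc k) xs) g ≈ sumMap xs (λ x → sumMap (allFns k xs) (λ f → g (x ∷ᶠ f)))
  sumMap-allFns-suc xs k g =
    trans (sumMap-concatMap xs _ g) (sumMap-cong xs (λ x → sumMap-map (allFns k xs) (x ∷ᶠ_) g))

  sumF-cong : ∀ k {f g : Fin k → Carrier} → (∀ i → f i ≈ g i) → sumF k f ≈ sumF k g
  sumF-cong zero    e = refl
  sumF-cong (suc k) e = +-cong (e zero) (sumF-cong k (λ i → e (suc i)))

  sumF-*ˡ : ∀ k r (f : Fin k → Carrier) → r * sumF k f ≈ sumF k (λ i → r * f i)
  sumF-*ˡ zero    r f = zeroʳ r
  sumF-*ˡ (suc k) r f = trans (distribˡ r _ _) (+-cong refl (sumF-*ˡ k r (λ i → f (suc i))))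

  prodF-cong : ∀ k {f g : Fin k → Carrier} → (∀ i → f i ≈ g i) → prodF k f ≈ prodF k g
  prodF-cong zero    e = refl
  prodF-cong (suc k) e = *-cong (e zero) (prodF-cong k (λ i → e (suc i)))

  prodF-const : ∀ k r → prodF k (λ _ → r) ≈ pow r k
  prodF-const zero    r = refl
  prodF-const (suc k) r = *-cong refl (prodF-const k r)

  prodF-except : ∀ k (v : Fin k) r → prodF k (λ i → if does (i ≟ v) then 1# else r) ≈ pow r (k ∸ 1)
  prodF-except (suc k)       zero    r = trans (*-identityˡ _) (prodF-const k r)
  prodF-except (suc (suc k)) (suc v) r = *-cong refl (prodF-except (suc k) v r)

  times-cong : ∀ k {r s} → r ≈ s → times k r ≈ times k s
  times-cong zero    e = refl
  times-cong (suc k) e = +-cong e (times-cong k e)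

  times-*ˡ : ∀ k r s → r * times k s ≈ times k (r * s)
  times-*ˡ zero    r s = zeroʳ r
  times-*ˡ (suc k) r s = trans (distribˡ r s (times k s)) (+-cong refl (times-*ˡ k r s))

  pow-cong : ∀ k {r s} → r ≈ s → pow r k ≈ pow s k
  pow-cong zero    e = refl
  pow-cong (suc k) e = *-cong e (pow-cong k e)

  pow-1# : ∀ k → pow 1# k ≈ 1#
  pow-1# zero    = refl
  pow-1# (suc k) = trans (*-identityˡ _) (pow-1# k)

  pow-+ : ∀ r a b → pow r (a ℕ.+ b) ≈ pow r a * pow r b
  pow-+ r zero    b = sym (*-identityˡ _)
  pow-+ r (suc a) b = trans (*-cong refl (pow-+ r a b)) (sym (*-assoc _ _ _))

  pow-* : ∀ r s k → pow (r * s) k ≈ pow r k * pow s k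
  pow-* r s zero    = sym (*-identityˡ 1#)
  pow-* r s (suc k) = trans (*-cong refl (pow-* r s k))
    (solve 4 (λ a b c d → (a :* b) :* (c :* d) := (a :* c) :* (b :* d))
           refl r s (pow r k) (pow s k))

  pow-prodF : ∀ m (f : Fin m → Carrier) k → pow (prodF m f) k ≈ prodF m (λ j → pow (f j) k)
  pow-prodF zero    f k = pow-1# k
  pow-prodF (suc m) f k = trans (pow-* _ _ k) (*-cong refl (pow-prodF m (λ j → f (suc j)) k))

  pow-sumℕ : ∀ r k (f : Fin k → ℕ) → pow r (sumℕ k f) ≈ prodF k (λ i → pow r (f i))
  pow-sumℕ r zero    f = refl
  pow-sumℕ r (suc k) f = trans (pow-+ r (f zero) _) (*-cong refl (pow-sumℕ r k (λ i → f (suc i))))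

  pow-anyF : ∀ x k (g : Fin k → Bool) →
    pow x (if anyF k g then 1 else 0) ≈ x + (1# - x) * prodF k (λ j → if g j then 0# else 1#)
  pow-anyF x zero    g = sym (trans (+-cong refl (*-identityʳ _)) (x+[1-x]≈1 x))
  pow-anyF x (suc k) g with g zero
  ... | true  = trans (*-identityʳ x)
    (sym (trans (+-cong refl (trans (*-cong refl (zeroˡ _)) (zeroʳ _))) (+-identityʳ x)))
  ... | false = trans (pow-anyF x k (λ j → g (suc j))) (+-cong refl (*-cong refl (sym (*-identityˡ _))))

  pow-binomial : ∀ n a b →
    pow (a + b) n ≈ sumF (suc n) (λ k → times (n C toℕ k) (pow a (toℕ k) * pow b (n ∸ toℕ k)))
  pow-binomial n a b = begin
    pow (a + b) n  ≈⟨ pow≈^ (a + b) n ⟩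
    (a + b) ^ᴿ n   ≈⟨ Binomial.theorem n a b ⟩
    sum {suc n} (λ k → (n C toℕ k) ×ᴿ ((a ^ᴿ toℕ k) * (b ^ᴿ (n ∸ toℕ k))))
      ≈⟨ sym (sumF≈sum (suc n) (λ k → (n C toℕ k) ×ᴿ ((a ^ᴿ toℕ k) * (b ^ᴿ (n ∸ toℕ k))))) ⟩
    sumF (suc n) (λ k → (n C toℕ k) ×ᴿ ((a ^ᴿ toℕ k) * (b ^ᴿ (n ∸ toℕ k))))
      ≈⟨ sumF-cong (suc n) (λ k → sym (trans (times≈× (n C toℕ k) _)
           (×-congʳ (n C toℕ k) (*-cong (pow≈^ a (toℕ k)) (pow≈^ b (n ∸ toℕ k)))))) ⟩
    sumF (suc n) (λ k → times (n C toℕ k) (pow a (toℕ k) * pow b (n ∸ toℕ k))) ∎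
    where
    pow≈^ : ∀ r k → pow r k ≈ r ^ᴿ k
    pow≈^ r zero    = refl
    pow≈^ r (suc k) = *-cong refl (pow≈^ r k)

    times≈× : ∀ k r → times k r ≈ k ×ᴿ r
    times≈× zero    r = refl
    times≈× (suc k) r = +-cong refl (times≈× k r)

    sumF≈sum : ∀ k (f : Fin k → Carrier) → sumF k f ≈ sum f
    sumF≈sum zero    f = refl
    sumF≈sum (suc k) f = +-cong refl (sumF≈sum k _)

    ×-congʳ : ∀ k {r s} → r ≈ s → k ×ᴿ r ≈ k ×ᴿ s
    ×-congʳ k e = trans (sym (times≈× k _)) (trans (times-cong k e) (times≈× k _))

  module ProductMeasure {a} {A : Set a} (xs : List A) (ω : A → Carrier) where

    prob : ∀ k → (Fin k → A) → Carrier
    prob k f = prodF k (λ i → ω (f i))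

    𝔼 : ∀ k → ((Fin k → A) → Carrier) → Carrier
    𝔼 k F = sumMap (allFns k xs) (λ f → prob k f * F f)

    mean : (A → Carrier) → Carrier
    mean g = sumMap xs (λ x → ω x * g x)

    𝔼-cong : ∀ k {F G : (Fin k → A) → Carrier} → (∀ f → F f ≈ G f) → 𝔼 k F ≈ 𝔼 k G
    𝔼-cong k e = sumMap-cong (allFns k xs) (λ f → *-cong refl (e f))

    𝔼-*ˡ : ∀ k r (F : (Fin k → A) → Carrier) → 𝔼 k (λ f → r * F f) ≈ r * 𝔼 k F
    𝔼-*ˡ k r F = trans
      (sumMap-cong (allFns k xs) (λ f →
        solve 3 (λ w r x → w :* (r :* x) := r :* (w :* x)) refl (prob k f) r (F f)))
      (sumMap-*ˡ (allFns k xs) r _)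

    𝔼-+ : ∀ k (F G : (Fin k → A) → Carrier) → 𝔼 k (λ f → F f + G f) ≈ 𝔼 k F + 𝔼 k G
    𝔼-+ k F G = trans (sumMap-cong (allFns k xs) (λ f → distribˡ (prob k f) (F f) (G f)))
                      (sumMap-+ (allFns k xs) _ _)

    𝔼-times : ∀ k c (F : (Fin k → A) → Carrier) → 𝔼 k (λ f → times c (F f)) ≈ times c (𝔼 k F)
    𝔼-times k c F = trans (sumMap-cong (allFns k xs) (λ f → times-*ˡ c (prob k f) (F f)))
                          (sumMap-times (allFns k xs) c _)

    𝔼-sumF : ∀ k n (F : Fin n → (Fin k → A) → Carrier) →
             𝔼 k (λ f → sumF n (λ i → F i f)) ≈ sumF n (λ i → 𝔼 k (F i))
    𝔼-sumF k n F = trans (sumMap-cong (allFns k xs) (λ f → sumF-*ˡ n (prob k f) _))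
                         (sumMap-sumF (allFns k xs) n _)

    𝔼-sumMap : ∀ {b} {B : Set b} k (ys : List B) (F : (Fin k → A) → B → Carrier) →
               𝔼 k (λ f → sumMap ys (F f)) ≈ sumMap ys (λ y → 𝔼 k (λ f → F f y))
    𝔼-sumMap k ys F = trans (sumMap-cong (allFns k xs) (λ f → sym (sumMap-*ˡ ys (prob k f) (F f))))
                            (sumMap-swap (allFns k xs) ys _)

    𝔼-suc : ∀ k (F : (Fin (suc k) → A) → Carrier) → 𝔼 (suc k) F ≈ mean (λ x → 𝔼 k (λ f → F (x ∷ᶠ f)))
    𝔼-suc k F = trans (sumMap-allFns-suc xs k _)
      (sumMap-cong xs (λ x → trans (sumMap-cong (allFns k xs) (λ f → *-assoc _ _ _))
                                   (sumMap-*ˡ (allFns k xs) (ω x) _)))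

    𝔼-const : sumMap xs ω ≈ 1# → ∀ k r → 𝔼 k (λ _ → r) ≈ r
    𝔼-const total zero    r = trans (+-identityʳ _) (*-identityˡ r)
    𝔼-const total (suc k) r = begin
      𝔼 (suc k) (λ _ → r)              ≈⟨ 𝔼-suc k _ ⟩
      sumMap xs (λ x → ω x * 𝔼 k (λ _ → r)) ≈⟨ sumMap-cong xs (λ x → *-cong refl (𝔼-const total k r)) ⟩
      sumMap xs (λ x → ω x * r)        ≈⟨ sumMap-*ʳ xs r ω ⟩
      sumMap xs ω * r                  ≈⟨ trans (*-cong total refl) (*-identityˡ r) ⟩
      r                                ∎

    𝔼-prodF : ∀ k (g : Fin k → A → Carrier) → 𝔼 k (λ f → prodF k (λ i → g i (f i))) ≈ prodF k (λ i → mean (g i))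
    𝔼-prodF zero    g = trans (+-identityʳ _) (*-identityˡ 1#)
    𝔼-prodF (suc k) g = begin
      𝔼 (suc k) (λ f → prodF (suc k) (λ i → g i (f i)))
        ≈⟨ 𝔼-suc k _ ⟩
      mean (λ x → 𝔼 k (λ f → g zero x * prodF k (λ i → g (suc i) (f i))))
        ≈⟨ sumMap-cong xs (λ x → *-cong refl
             (trans (𝔼-*ˡ k (g zero x) _) (*-cong refl (𝔼-prodF k (λ i → g (suc i)))))) ⟩
      mean (λ x → g zero x * prodF k (λ i → mean (g (suc i))))
        ≈⟨ trans (sumMap-cong xs (λ x → sym (*-assoc _ _ _))) (sumMap-*ʳ xs _ _) ⟩
      prodF (suc k) (λ i → mean (g i)) ∎

    -- Conditioning on f v makes the factors at the other coordinates independent.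
    𝔼-condition : ∀ k (v : Fin k) (h : A → Carrier) (φ : Fin k → A → A → Carrier) →
      𝔼 k (λ f → h (f v) * prodF k (λ i → φ i (f v) (f i)))
      ≈ mean (λ a → h a * prodF k (λ i → if does (i ≟ v) then φ i a a else mean (φ i a)))
    𝔼-condition (suc k) zero h φ =
      trans (𝔼-suc k _) (sumMap-cong xs (λ x → *-cong refl
        (trans (𝔼-cong k (λ f → sym (*-assoc _ _ _)))
        (trans (𝔼-*ˡ k _ _) (trans (*-cong refl (𝔼-prodF k (λ i → φ (suc i) x))) (*-assoc _ _ _))))))
    𝔼-condition (suc k) (suc v) h φ = begin
      𝔼 (suc k) (λ f → h (f (suc v)) * prodF (suc k) (λ i → φ i (f (suc v)) (f i)))
        ≈⟨ 𝔼-suc k _ ⟩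
      mean (λ b → 𝔼 k (λ f → h (f v) * (φ zero (f v) b * prodF k (λ i → φ (suc i) (f v) (f i)))))
        ≈⟨ sumMap-cong xs (λ b → *-cong refl (trans (𝔼-cong k (λ f → sym (*-assoc _ _ _)))
             (𝔼-condition k v (λ r → h r * φ zero r b) (λ i → φ (suc i))))) ⟩
      mean (λ b → mean (λ a → (h a * φ zero a b) * rest a))
        ≈⟨ trans (sumMap-cong xs (λ b → sym (sumMap-*ˡ xs (ω b) _))) (sumMap-swap xs xs _) ⟩
      sumMap xs (λ a → sumMap xs (λ b → ω b * (ω a * ((h a * φ zero a b) * rest a))))
        ≈⟨ sumMap-cong xs (λ a → trans (sumMap-cong xs (λ b →
              solve 5 (λ wb wa ha ph pa → wb :* (wa :* ((ha :* ph) :* pa)) := (wa :* ha :* pa) :* (wb :* ph))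
                refl (ω b) (ω a) (h a) (φ zero a b) (rest a)))
             (trans (sumMap-*ˡ xs _ _)
               (solve 4 (λ wa ha pa q → (wa :* ha :* pa) :* q := wa :* (ha :* (q :* pa)))
                  refl (ω a) (h a) (rest a) _))) ⟩
      mean (λ a → h a * prodF (suc k) (λ i → if does (i ≟ suc v) then φ i a a else mean (φ i a))) ∎
      where
      rest : A → Carrier
      rest a = prodF k (λ i → if does (i ≟ v) then φ (suc i) a a else mean (φ (suc i) a))

  module RandomMatrix {a} {A : Set a} (xs : List A) (ω : A → Carrier) where
    module Entries = ProductMeasure xs ω
    module Rows (k : ℕ) = ProductMeasure (allFns k xs) (Entries.prob k)

    transpose : ∀ {n m} → (Fin n → Fin m → A) → Fin m → Fin n → A
    transpose G j i = G i j

    -- Without function extensionality, invariance under pointwise equal matrices is assumed.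
    Congruent : ∀ {n m} → ((Fin n → Fin m → A) → Carrier) → Set (a ⊔ ℓ)
    Congruent F = ∀ G G′ → (∀ i j → G i j ≡ G′ i j) → F G ≈ F G′

    𝔼-cons-column : ∀ n m (K : (Fin m → A) → (Fin m → Fin n → A) → Carrier) →
      (∀ r r′ H H′ → (∀ j → r j ≡ r′ j) → (∀ j i → H j i ≡ H′ j i) → K r H ≈ K r′ H′) →
      Entries.𝔼 m (λ r → Rows.𝔼 n m (K r))
      ≈ Rows.𝔼 (suc n) m (λ H → K (λ j → H j zero) (λ j i → H j (suc i)))
    𝔼-cons-column n zero K K-cong =
      trans (trans (+-identityʳ _) (trans (*-identityˡ _) (trans (+-identityʳ _) (*-identityˡ _))))
            (trans (K-cong _ _ _ _ (λ ()) (λ ())) (sym (trans (+-identityʳ _) (*-identityˡ _))))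
    𝔼-cons-column n (suc m) K K-cong = begin
      Entries.𝔼 (suc m) (λ r → Rows.𝔼 n (suc m) (K r))
        ≈⟨ Entries.𝔼-suc m _ ⟩
      Entries.mean (λ a → Entries.𝔼 m (λ r → Rows.𝔼 n (suc m) (K (a ∷ᶠ r))))
        ≈⟨ sumMap-cong xs (λ a → *-cong refl (trans
             (Entries.𝔼-cong m (λ r → Rows.𝔼-suc n m (K (a ∷ᶠ r))))
             (Entries.𝔼-sumMap m (allFns n xs) _))) ⟩
      Entries.mean (λ a → sumMap (allFns n xs) (λ b →
        Entries.𝔼 m (λ r → Entries.prob n b * Rows.𝔼 n m (λ H → K (a ∷ᶠ r) (b ∷ᶠ H)))))
        ≈⟨ sumMap-cong xs (λ a → *-cong refl (sumMap-cong (allFns n xs) (λ b →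
             trans (Entries.𝔼-*ˡ m _ _) (*-cong refl (𝔼-cons-column n m (λ r H → K (a ∷ᶠ r) (b ∷ᶠ H))
               (λ r r′ H H′ er eH → K-cong _ _ _ _ (λ { zero → ≡.refl ; (suc j) → er j })
                                                   (λ { zero i → ≡.refl ; (suc j) i → eH j i }))))))) ⟩
      Entries.mean (λ a → sumMap (allFns n xs) (λ b →
        Entries.prob n b * Rows.𝔼 (suc n) m (λ H → K (a ∷ᶠ col₀ H) (b ∷ᶠ rest H))))
        ≈⟨ sumMap-cong xs (λ a → trans (sym (sumMap-*ˡ (allFns n xs) (ω a) _))
             (sumMap-cong (allFns n xs) (λ b → trans (sym (*-assoc _ _ _)) (*-cong refl
               (Rows.𝔼-cong (suc n) m (λ H → K-cong _ _ _ _ (λ { zero → ≡.refl ; (suc j) → ≡.refl })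
                                                             (λ { zero i → ≡.refl ; (suc j) i → ≡.refl }))))))) ⟩
      sumMap xs (λ a → sumMap (allFns n xs) (λ b → summand (a ∷ᶠ b)))
        ≈⟨ sym (sumMap-allFns-suc xs n summand) ⟩
      Rows.mean (suc n) (λ c → Rows.𝔼 (suc n) m (λ H → K (col₀ (c ∷ᶠ H)) (rest (c ∷ᶠ H))))
        ≈⟨ sym (Rows.𝔼-suc (suc n) m _) ⟩
      Rows.𝔼 (suc n) (suc m) (λ H → K (col₀ H) (rest H)) ∎
      where
      col₀ : ∀ {k} → (Fin k → Fin (suc n) → A) → Fin k → A
      col₀ H j = H j zero
      rest : ∀ {k} → (Fin k → Fin (suc n) → A) → Fin k → Fin n → A
      rest H j i = H j (suc i)
      summand : (Fin (suc n) → A) → Carrier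
      summand c = Entries.prob (suc n) c * Rows.𝔼 (suc n) m (λ H → K (col₀ (c ∷ᶠ H)) (rest (c ∷ᶠ H)))

    𝔼-transpose : ∀ n m (F : (Fin n → Fin m → A) → Carrier) → Congruent F →
                  Rows.𝔼 m n F ≈ Rows.𝔼 n m (λ H → F (transpose H))
    𝔼-transpose zero m F F-cong = begin
      Rows.𝔼 m 0 F                  ≈⟨ trans (+-identityʳ _) (*-identityˡ _) ⟩
      F (λ ())                      ≈⟨ sym (Rows.𝔼-const 0 (+-identityʳ 1#) m _) ⟩
      Rows.𝔼 0 m (λ _ → F (λ ()))   ≈⟨ Rows.𝔼-cong 0 m (λ H → F-cong _ _ (λ ())) ⟩
      Rows.𝔼 0 m (λ H → F (transpose H)) ∎
    𝔼-transpose (suc n) m F F-cong = begin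
      Rows.𝔼 m (suc n) F
        ≈⟨ Rows.𝔼-suc m n F ⟩
      Entries.𝔼 m (λ r → Rows.𝔼 m n (λ G → F (r ∷ᶠ G)))
        ≈⟨ Entries.𝔼-cong m (λ r → 𝔼-transpose n m (λ G → F (r ∷ᶠ G))
             (λ G G′ e → F-cong _ _ (λ { zero j → ≡.refl ; (suc i) j → e i j }))) ⟩
      Entries.𝔼 m (λ r → Rows.𝔼 n m (λ H → F (r ∷ᶠ transpose H)))
        ≈⟨ 𝔼-cons-column n m (λ r H → F (r ∷ᶠ transpose H))
             (λ r r′ H H′ er eH → F-cong _ _ (λ { zero j → er j ; (suc i) j → eH j i })) ⟩
      Rows.𝔼 (suc n) m (λ H → F ((λ j → H j zero) ∷ᶠ transpose (λ j i → H j (suc i))))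
        ≈⟨ Rows.𝔼-cong (suc n) m (λ H → F-cong _ _ (λ { zero j → ≡.refl ; (suc i) j → ≡.refl })) ⟩
      Rows.𝔼 (suc n) m (λ H → F (transpose H)) ∎

module BipartiteDegrees {c ℓ : Level} (R : CommutativeRing c ℓ) (p x : CommutativeRing.Carrier R) where
  open CommutativeRing R hiding (zero)
  open RingDefs R
  open Expectation R
  open import Relation.Binary.Reasoning.Setoid setoid
  open import Algebra.Solver.Ring.NaturalCoefficients.Default commutativeSemiring
    using (solve; _:=_; _:*_)

  bernoulli : Bool → Carrier
  bernoulli b = if b then p else 1# - p

  bools : List Bool
  bools = true ∷ false ∷ []

  open RandomMatrix bools bernoulli

  bernoulli-total : sumMap bools bernoulli ≈ 1#
  bernoulli-total = trans (+-cong refl (+-identityʳ _)) (x+[1-x]≈1 p)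

  -- The probability that a random row avoids every column where a is set.
  avoidProb : ∀ {m} → (Fin m → Bool) → Carrier
  avoidProb {m} a = prodF m (λ j → if a j then 1# - p else 1#)

  mean-avoid : ∀ c → Entries.mean (λ b → if c ∧ b then 0# else 1#) ≈ (if c then 1# - p else 1#)
  mean-avoid true  = trans (+-cong (zeroʳ p) (trans (+-identityʳ _) (*-identityʳ _))) (+-identityˡ _)
  mean-avoid false = trans (+-cong (*-identityʳ p) (trans (+-identityʳ _) (*-identityʳ _))) (x+[1-x]≈1 p)

  𝔼-pow-share : ∀ m (a : Fin m → Bool) →
    Entries.𝔼 m (λ b → pow x (if anyF m (λ j → a j ∧ b j) then 1 else 0)) ≈ x + (1# - x) * avoidProb a
  𝔼-pow-share m a = begin
    Entries.𝔼 m (λ b → pow x (if anyF m (λ j → a j ∧ b j) then 1 else 0))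
      ≈⟨ Entries.𝔼-cong m (λ b → pow-anyF x m (λ j → a j ∧ b j)) ⟩
    Entries.𝔼 m (λ b → x + (1# - x) * prodF m (λ j → if a j ∧ b j then 0# else 1#))
      ≈⟨ Entries.𝔼-+ m _ _ ⟩
    Entries.𝔼 m (λ _ → x) + Entries.𝔼 m (λ b → (1# - x) * prodF m (λ j → if a j ∧ b j then 0# else 1#))
      ≈⟨ +-cong (Entries.𝔼-const bernoulli-total m x) (Entries.𝔼-*ˡ m (1# - x) _) ⟩
    x + (1# - x) * Entries.𝔼 m (λ b → prodF m (λ j → if a j ∧ b j then 0# else 1#))
      ≈⟨ +-cong refl (*-cong refl (trans (Entries.𝔼-prodF m (λ j b → if a j ∧ b then 0# else 1#))
                                          (prodF-cong m (λ j → mean-avoid (a j))))) ⟩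
    x + (1# - x) * avoidProb a ∎

  𝔼-pow-avoidProb : ∀ m k → Entries.𝔼 m (λ a → pow (avoidProb a) k) ≈ pow ((1# - p) + p * pow (1# - p) k) m
  𝔼-pow-avoidProb m k = begin
    Entries.𝔼 m (λ a → pow (avoidProb a) k)
      ≈⟨ Entries.𝔼-cong m (λ a → pow-prodF m _ k) ⟩
    Entries.𝔼 m (λ a → prodF m (λ j → pow (if a j then 1# - p else 1#) k))
      ≈⟨ Entries.𝔼-prodF m (λ j b → pow (if b then 1# - p else 1#) k) ⟩
    prodF m (λ _ → Entries.mean (λ b → pow (if b then 1# - p else 1#) k))
      ≈⟨ prodF-cong m (λ _ → trans (+-cong refl (trans (+-identityʳ _)
           (trans (*-cong refl (pow-1# k)) (*-identityʳ _)))) (+-comm _ _)) ⟩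
    prodF m (λ _ → (1# - p) + p * pow (1# - p) k)
      ≈⟨ prodF-const m _ ⟩
    pow ((1# - p) + p * pow (1# - p) k) m ∎

  𝔼-pow-degActive-conditioned : ∀ n m (v : Fin (suc n)) →
    expect (suc n) m p (λ G → pow x (degActive G v)) ≈ Entries.𝔼 m (λ a → pow (x + (1# - x) * avoidProb a) n)
  𝔼-pow-degActive-conditioned n m v = begin
    Rows.𝔼 m (suc n) (λ G → pow x (degActive G v))
      ≈⟨ Rows.𝔼-cong m (suc n) (λ G → trans (pow-sumℕ x (suc n) (degree-term G)) (sym (*-identityˡ _))) ⟩
    Rows.𝔼 m (suc n) (λ G → 1# * prodF (suc n) (λ i → φ i (G v) (G i)))
      ≈⟨ Rows.𝔼-condition m (suc n) v (λ _ → 1#) φ ⟩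
    Entries.𝔼 m (λ a → 1# * prodF (suc n) (λ i → if does (i ≟ v) then φ i a a else Entries.𝔼 m (φ i a)))
      ≈⟨ Entries.𝔼-cong m (λ a → trans (*-identityˡ _)
           (trans (prodF-cong (suc n) (λ i → diagonal (does (i ≟ v)) a)) (prodF-except (suc n) v _))) ⟩
    Entries.𝔼 m (λ a → pow (Entries.𝔼 m (λ b → pow x (if anyF m (λ j → a j ∧ b j) then 1 else 0))) n)
      ≈⟨ Entries.𝔼-cong m (λ a → pow-cong n (𝔼-pow-share m a)) ⟩
    Entries.𝔼 m (λ a → pow (x + (1# - x) * avoidProb a) n) ∎
    where
    degree-term : BipGraph (suc n) m → Fin (suc n) → ℕ
    degree-term G i = if does (i ≟ v) then 0 else (if anyF m (λ j → G v j ∧ G i j) then 1 else 0)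

    φ : Fin (suc n) → (Fin m → Bool) → (Fin m → Bool) → Carrier
    φ i a b = pow x (if does (i ≟ v) then 0 else (if anyF m (λ j → a j ∧ b j) then 1 else 0))

    diagonal : ∀ (d : Bool) a →
      (if d then pow x (if d then 0 else (if anyF m (λ j → a j ∧ a j) then 1 else 0))
            else Entries.𝔼 m (λ b → pow x (if d then 0 else (if anyF m (λ j → a j ∧ b j) then 1 else 0))))
      ≈ (if d then 1# else Entries.𝔼 m (λ b → pow x (if anyF m (λ j → a j ∧ b j) then 1 else 0)))
    diagonal true  a = refl
    diagonal false a = refl

  𝔼-pow-degActive : ∀ n m (v : Fin n) → expect n m p (λ G → pow x (degActive G v)) ≈ rhs n m p x
  𝔼-pow-degActive (suc n) m v = begin
    expect (suc n) m p (λ G → pow x (degActive G v))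
      ≈⟨ 𝔼-pow-degActive-conditioned n m v ⟩
    Entries.𝔼 m (λ a → pow (x + (1# - x) * avoidProb a) n)
      ≈⟨ Entries.𝔼-cong m expand ⟩
    Entries.𝔼 m (λ a → sumF (suc n) (λ i → times (n C toℕ i) (coeff i * pow (avoidProb a) (toℕ i))))
      ≈⟨ Entries.𝔼-sumF m (suc n) (λ i a → times (n C toℕ i) (coeff i * pow (avoidProb a) (toℕ i))) ⟩
    sumF (suc n) (λ i → Entries.𝔼 m (λ a → times (n C toℕ i) (coeff i * pow (avoidProb a) (toℕ i))))
      ≈⟨ sumF-cong (suc n) (λ i → trans (Entries.𝔼-times m (n C toℕ i) _) (times-cong (n C toℕ i)
           (trans (Entries.𝔼-*ˡ m (coeff i) _) (*-cong refl (𝔼-pow-avoidProb m (toℕ i)))))) ⟩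
    rhs (suc n) m p x ∎
    where
    coeff : Fin (suc n) → Carrier
    coeff i = pow x (n ∸ toℕ i) * pow (1# - x) (toℕ i)

    expand : ∀ a → pow (x + (1# - x) * avoidProb a) n
                   ≈ sumF (suc n) (λ i → times (n C toℕ i) (coeff i * pow (avoidProb a) (toℕ i)))
    expand a = trans (pow-cong n (+-comm _ _)) (trans (pow-binomial n ((1# - x) * avoidProb a) x)
      (sumF-cong (suc n) (λ i → times-cong (n C toℕ i) (trans (*-cong (pow-* (1# - x) (avoidProb a) (toℕ i)) refl)
        (solve 3 (λ u q w → (u :* q) :* w := (w :* u) :* q)
               refl (pow (1# - x) (toℕ i)) (pow (avoidProb a) (toℕ i)) (pow x (n ∸ toℕ i)))))))

  pow-degPassive-congruent : ∀ {n m} (w : Fin m) → Congruent {n} {m} (λ G → pow x (degPassive G w))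
  pow-degPassive-congruent {n} {m} w G G′ e = reflexive (≡.cong (pow x) (sumℕ-cong m (λ w′ →
    ≡.cong (λ b → if does (w′ ≟ w) then 0 else (if b then 1 else 0))
           (anyF-cong n (λ v → ≡.cong₂ _∧_ (e v w) (e v w′))))))

  -- The passive degree of w in G is, definitionally, the active degree of w in transpose G.
  𝔼-pow-degPassive : ∀ n m (w : Fin m) → expect n m p (λ G → pow x (degPassive G w)) ≈ rhs m n p x
  𝔼-pow-degPassive n m w = trans (𝔼-transpose n m _ (pow-degPassive-congruent w)) (𝔼-pow-degActive m n w)

corollary1 : ∀ {c ℓ : Level} (R : CommutativeRing c ℓ) →
    let open CommutativeRing R
        open RingDefs R
    in (n m : ℕ) (v : Fin n) (w : Fin m) (p x y : Carrier) →
       (expect n m p (λ G → pow x (degActive G v)) ≈ rhs n m p x)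
       × (expect n m p (λ G → pow y (degPassive G w)) ≈ rhs m n p y)
corollary1 R n m v w p x y =
  BipartiteDegrees.𝔼-pow-degActive R p x n m v , BipartiteDegrees.𝔼-pow-degPassive R p y n m w
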